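{- Let $n$ jobs have deterministic lengths $l_1,\dots,l_n\ge0$ and weights $w_1,\dots,w_n>0$, and let $\alpha_i=l_i/w_i$. For any partition of $\{1,\dots,n\}$ into disjoint sets $A$ and $B$, $$\sum_{i,j\in A,\ j\ge i} w_iw_j\min(\alpha_i,\alpha_j)+\sum_{i,j\in B,\ j\ge i}w_iw_j\min(\alpha_i,\alpha_j)\ \ge\ \sum_{i\in A,\ j\in B}w_iw_j\min(\alpha_i,\alpha_j).$$
   Context: The sums over $j\ge i$ include the diagonal terms $i=j$.
   Formalization: The job lengths $l_1,\dots,l_n$ and weights $w_1,\dots,w_n$ are rational numbers. -}

module Defs where

open import Data.Nat using (ℕ; zero; suc) renaming (_≤ᵇ_ to _≤ℕᵇ_)
open import Data.Bool using (Bool; true; false; _∧_; if_then_else_)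
open import Data.Fin using (Fin; zero; suc; toℕ)
open import Data.Fin.Subset using (Subset; ∁)
open import Data.Vec using (lookup)
open import Data.Rational using (ℚ; 0ℚ; _+_; _*_; _÷_; _⊓_; _<_; _≤_; positive)
open import Data.Rational.Properties using (pos⇒nonZero)

Σ : ∀ {n} → (Fin n → ℚ) → ℚ
Σ {zero}  f = 0ℚ
Σ {suc n} f = f zero + Σ (λ i → f (suc i))

_∈ᵇ_ : ∀ {n} → Fin n → Subset n → Bool
i ∈ᵇ S = lookup S i

α : ∀ {n} (l w : Fin n → ℚ) → (∀ i → 0ℚ < w i) → Fin n → ℚ
α l w wpos i = (l i ÷ w i) {{pos⇒nonZero (w i) {{positive (wpos i)}}}}

term : ∀ {n} (l w : Fin n → ℚ) → (∀ i → 0ℚ < w i) → Fin n → Fin n → ℚ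
term l w wpos i j = w i * w j * (α l w wpos i ⊓ α l w wpos j)

sumWithin : ∀ {n} (l w : Fin n → ℚ) → (∀ i → 0ℚ < w i) → Subset n → ℚ
sumWithin l w wpos S =
  Σ (λ i → Σ (λ j → if (i ∈ᵇ S) ∧ (j ∈ᵇ S) ∧ (toℕ i ≤ℕᵇ toℕ j)
                    then term l w wpos i j else 0ℚ))

sumAcross : ∀ {n} (l w : Fin n → ℚ) → (∀ i → 0ℚ < w i) → Subset n → Subset n → ℚ
sumAcross l w wpos S T =
  Σ (λ i → Σ (λ j → if (i ∈ᵇ S) ∧ (j ∈ᵇ T) then term l w wpos i j else 0ℚ))

-- Put x i = w i on A and x i = − w i on B = ∁ A. Expanding the quadratic form of the min kernel,
--   Σ_{i,j} x i x j min(α i, α j) = T_AA + T_BB − 2 T_AB,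
-- where T_ST is the full double sum of w i w j min(α i, α j) over S × T. The min kernel of
-- nonnegative α is positive semidefinite: subtracting m = min α from every α i splits off
-- m (Σ x)², and what is left vanishes on the row and column of an index where α i = m, so
-- induction on n applies. Hence 2 T_AB ≤ T_AA + T_BB, while T_SS ≤ 2 Σ_{i ≤ j in S} by symmetry.
module Submission where

open import Defs
open import Data.Nat using (ℕ; zero; suc) renaming (_≤ᵇ_ to _≤ℕᵇ_)
import Data.Nat.Properties as ℕ
open import Data.Bool using (true; false; _∧_; not; if_then_else_; T)
open import Data.Bool.Properties using (∧-comm)
open import Data.Fin using (Fin; zero; suc; toℕ; punchIn)
open import Data.Fin.Subset using (Subset; ∁)
open import Data.Vec using (lookup)
open import Data.Vec.Properties using (lookup-map)
open import Data.Vec.Functional using (removeAt)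
open import Data.Rational
  using (ℚ; 0ℚ; _+_; _*_; _-_; -_; _⊓_; _≤_; _<_; 1/_; Positive; nonNegative; nonPositive; positive)
open import Data.Rational.Properties
open import Data.Rational.Solver using (module +-*-Solver)
open import Algebra.Bundles using (Ring; CommutativeMonoid)
open import Algebra.Properties.CommutativeSemigroup
  (CommutativeMonoid.commutativeSemigroup +-0-commutativeMonoid) using (interchange)
open import Algebra.Properties.Semiring.Sum (Ring.semiring +-*-ring)
  using ( sum; sum-syntax; sum-cong-≗; ∑-distrib-+; ∑-comm; sum-remove; sum-replicate-zero
        ; *-distribˡ-sum; *-distribʳ-sum)
open import Data.Empty using (⊥-elim)
open import Data.Product using (∃; _,_)
open import Data.Sum using (_⊎_; inj₁; inj₂)
import Data.Sum as Sum
open import Function using (_∘_)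
open import Relation.Nullary using (yes; no)
open import Relation.Binary.PropositionalEquality
open +-*-Solver

Σ≡sum : ∀ {n} (f : Fin n → ℚ) → Σ f ≡ sum f
Σ≡sum {zero}  f = refl
Σ≡sum {suc n} f = cong (f zero +_) (Σ≡sum (f ∘ suc))

ΣΣ≡∑∑ : ∀ {n} (f : Fin n → Fin n → ℚ) →
        Σ (λ i → Σ (λ j → f i j)) ≡ ∑[ i < n ] ∑[ j < n ] f i j
ΣΣ≡∑∑ f = trans (Σ≡sum (λ i → Σ (f i))) (sum-cong-≗ (λ i → Σ≡sum (f i)))

sum-mono-≤ : ∀ {n} {f g : Fin n → ℚ} → (∀ i → f i ≤ g i) → sum f ≤ sum g
sum-mono-≤ {zero}  f≤g = ≤-refl
sum-mono-≤ {suc n} f≤g = +-mono-≤ (f≤g zero) (sum-mono-≤ (f≤g ∘ suc))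

sum-removeAt-zero : ∀ {n} (f : Fin (suc n) → ℚ) p → f p ≡ 0ℚ → sum f ≡ sum (removeAt f p)
sum-removeAt-zero f p fp≡0 = begin
  sum f                      ≡⟨ sum-remove f ⟩
  f p + sum (removeAt f p)   ≡⟨ cong (_+ sum (removeAt f p)) fp≡0 ⟩
  0ℚ + sum (removeAt f p)    ≡⟨ +-identityˡ _ ⟩
  sum (removeAt f p)         ∎
  where open ≡-Reasoning

∑∑-product : ∀ {n} (x : Fin n → ℚ) →
             ∑[ i < n ] ∑[ j < n ] (x i * x j) ≡ sum x * sum x
∑∑-product x = begin
  sum (λ i → sum (λ j → x i * x j)) ≡⟨ sum-cong-≗ (λ i → sym (*-distribˡ-sum (x i) x)) ⟩
  sum (λ i → x i * sum x)           ≡⟨ sym (*-distribʳ-sum (sum x) x) ⟩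
  sum x * sum x                     ∎
  where open ≡-Reasoning

∑∑-scale : ∀ {n} c (f : Fin n → Fin n → ℚ) →
           ∑[ i < n ] ∑[ j < n ] (c * f i j) ≡ c * ∑[ i < n ] ∑[ j < n ] f i j
∑∑-scale c f = trans (sum-cong-≗ (λ i → sym (*-distribˡ-sum c (f i))))
                     (sym (*-distribˡ-sum c (λ i → sum (f i))))

∑∑-distrib-+ : ∀ {n} (f g : Fin n → Fin n → ℚ) →
               ∑[ i < n ] ∑[ j < n ] (f i j + g i j)
               ≡ ∑[ i < n ] ∑[ j < n ] f i j + ∑[ i < n ] ∑[ j < n ] g i j
∑∑-distrib-+ f g = trans (sum-cong-≗ (λ i → ∑-distrib-+ (f i) (g i)))
                         (∑-distrib-+ (λ i → sum (f i)) (λ i → sum (g i)))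

nonNeg+ : ∀ {p q} → 0ℚ ≤ p → 0ℚ ≤ q → 0ℚ ≤ p + q
nonNeg+ {p} {q} 0≤p 0≤q = nonNegative⁻¹ (p + q)
  {{nonNeg+nonNeg⇒nonNeg p {{nonNegative 0≤p}} q {{nonNegative 0≤q}}}}

nonNeg* : ∀ {p q} → 0ℚ ≤ p → 0ℚ ≤ q → 0ℚ ≤ p * q
nonNeg* {p} {q} 0≤p 0≤q = nonNegative⁻¹ (p * q)
  {{nonNeg*nonNeg⇒nonNeg p {{nonNegative 0≤p}} q {{nonNegative 0≤q}}}}

p*p≥0 : ∀ p → 0ℚ ≤ p * p
p*p≥0 p with ≤-total 0ℚ p
... | inj₁ 0≤p = nonNeg* 0≤p 0≤p
... | inj₂ p≤0 = nonNegative⁻¹ (p * p)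
  {{nonPos*nonPos⇒nonPos p {{nonPositive p≤0}} p {{nonPositive p≤0}}}}

p≤p+q : ∀ p {q} → 0ℚ ≤ q → p ≤ p + q
p≤p+q p 0≤q = subst (_≤ p + _) (+-identityʳ p) (+-monoʳ-≤ p 0≤q)

p+p≤q+q⇒p≤q : ∀ {p q} → p + p ≤ q + q → p ≤ q
p+p≤q+q⇒p≤q {p} {q} p+p≤q+q with p ≤? q
... | yes p≤q = p≤q
... | no  p≰q = ⊥-elim (<-irrefl refl (<-≤-trans (+-mono-< q<p q<p) p+p≤q+q))
  where q<p = ≰⇒> p≰q

argmin : ∀ {n} (a : Fin (suc n) → ℚ) → ∃ λ p → ∀ j → a p ≤ a j
argmin {zero}  a = zero , λ { zero → ≤-refl }
argmin {suc n} a with argmin (a ∘ suc)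
... | p , min with ≤-total (a zero) (a (suc p))
...   | inj₁ a₀≤ = zero  , λ { zero → ≤-refl ; (suc j) → ≤-trans a₀≤ (min j) }
...   | inj₂ ≤a₀ = suc p , λ { zero → ≤a₀   ; (suc j) → min j }

quadForm : ∀ {n} → (Fin n → ℚ) → (Fin n → Fin n → ℚ) → ℚ
quadForm {n} x K = ∑[ i < n ] ∑[ j < n ] (x i * x j * K i j)

minKernel : ∀ {n} → (Fin n → ℚ) → Fin n → Fin n → ℚ
minKernel a i j = a i ⊓ a j

quadForm-minKernel-shift : ∀ {n} (x a : Fin n → ℚ) c →
  quadForm x (minKernel a) ≡ c * (sum x * sum x) + quadForm x (minKernel (λ i → a i - c))
quadForm-minKernel-shift {n} x a c = begin
  quadForm x (minKernel a)
    ≡⟨ sum-cong-≗ (λ i → sum-cong-≗ (λ j → split i j)) ⟩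
  ∑[ i < n ] ∑[ j < n ] (c * (x i * x j) + x i * x j * ((a i - c) ⊓ (a j - c)))
    ≡⟨ ∑∑-distrib-+ (λ i j → c * (x i * x j)) (λ i j → x i * x j * ((a i - c) ⊓ (a j - c))) ⟩
  ∑[ i < n ] ∑[ j < n ] (c * (x i * x j)) + quadForm x (minKernel (λ i → a i - c))
    ≡⟨ cong (_+ quadForm x (minKernel (λ i → a i - c)))
         (trans (∑∑-scale c (λ i j → x i * x j)) (cong (c *_) (∑∑-product x))) ⟩
  c * (sum x * sum x) + quadForm x (minKernel (λ i → a i - c)) ∎
  where
  open ≡-Reasoning
  split : ∀ i j → x i * x j * (a i ⊓ a j)
                  ≡ c * (x i * x j) + x i * x j * ((a i - c) ⊓ (a j - c))
  split i j = begin
    x i * x j * (a i ⊓ a j)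
      ≡⟨ solve 4 (λ u v m c → u :* v :* m := c :* (u :* v) :+ u :* v :* (m :- c)) refl
           (x i) (x j) (a i ⊓ a j) c ⟩
    c * (x i * x j) + x i * x j * (a i ⊓ a j - c)
      ≡⟨ cong (λ m → c * (x i * x j) + x i * x j * m)
           (mono-≤-distrib-⊓ (+-monoˡ-≤ (- c)) (a i) (a j)) ⟩
    c * (x i * x j) + x i * x j * ((a i - c) ⊓ (a j - c)) ∎

quadForm-minKernel-removeAt : ∀ {n} (x b : Fin (suc n) → ℚ) p →
  (∀ i → 0ℚ ≤ b i) → b p ≡ 0ℚ →
  quadForm x (minKernel b) ≡ quadForm (removeAt x p) (minKernel (removeAt b p))
quadForm-minKernel-removeAt {n} x b p b≥0 bp≡0 = begin
  quadForm x (minKernel b)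
    ≡⟨ sum-removeAt-zero (λ i → ∑[ j < suc n ] (x i * x j * (b i ⊓ b j))) p
         (trans (sum-cong-≗ (λ j → entry≡0 p j (inj₁ refl))) (sum-replicate-zero (suc n))) ⟩
  ∑[ i < n ] ∑[ j < suc n ] (x (pin i) * x j * (b (pin i) ⊓ b j))
    ≡⟨ sum-cong-≗ (λ i → sum-removeAt-zero (λ j → x (pin i) * x j * (b (pin i) ⊓ b j)) p
                                            (entry≡0 (pin i) p (inj₂ refl))) ⟩
  quadForm (removeAt x p) (minKernel (removeAt b p)) ∎
  where
  open ≡-Reasoning
  pin : Fin n → Fin (suc n)
  pin = punchIn p
  entry≡0 : ∀ i j → i ≡ p ⊎ j ≡ p → x i * x j * (b i ⊓ b j) ≡ 0ℚ
  entry≡0 i j i∨j≡p = trans (cong (x i * x j *_) (min≡0 i∨j≡p)) (*-zeroʳ (x i * x j))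
    where
    min≡0 : i ≡ p ⊎ j ≡ p → b i ⊓ b j ≡ 0ℚ
    min≡0 (inj₁ refl) = trans (cong (_⊓ b j) bp≡0) (p≤q⇒p⊓q≡p (b≥0 j))
    min≡0 (inj₂ refl) = trans (cong (b i ⊓_) bp≡0) (p≥q⇒p⊓q≡q (b≥0 i))

minKernel-psd : ∀ {n} (a : Fin n → ℚ) → (∀ i → 0ℚ ≤ a i) →
                ∀ x → 0ℚ ≤ quadForm x (minKernel a)
minKernel-psd {zero}  a a≥0 x = ≤-refl
minKernel-psd {suc n} a a≥0 x with argmin a
... | p , min = subst (0ℚ ≤_) (sym (quadForm-minKernel-shift x a (a p)))
                  (nonNeg+ (nonNeg* (a≥0 p) (p*p≥0 (sum x))) rest≥0)
  where
  b : Fin (suc n) → ℚ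
  b i = a i - a p
  b≥0 : ∀ i → 0ℚ ≤ b i
  b≥0 i = subst (_≤ b i) (+-inverseʳ (a p)) (+-monoˡ-≤ (- a p) (min i))
  rest≥0 : 0ℚ ≤ quadForm x (minKernel b)
  rest≥0 = subst (0ℚ ≤_) (sym (quadForm-minKernel-removeAt x b p b≥0 (+-inverseʳ (a p))))
             (minKernel-psd (removeAt b p) (b≥0 ∘ punchIn p) (removeAt x p))

scaledKernel : ∀ {n} → (Fin n → ℚ) → (Fin n → Fin n → ℚ) → Fin n → Fin n → ℚ
scaledKernel w K i j = w i * w j * K i j

block : ∀ {n} → Subset n → Subset n → (Fin n → Fin n → ℚ) → ℚ
block {n} S T M = ∑[ i < n ] ∑[ j < n ] (if (i ∈ᵇ S) ∧ (j ∈ᵇ T) then M i j else 0ℚ)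

upperBlock : ∀ {n} → Subset n → (Fin n → Fin n → ℚ) → ℚ
upperBlock {n} S M =
  ∑[ i < n ] ∑[ j < n ] (if (i ∈ᵇ S) ∧ (j ∈ᵇ S) ∧ (toℕ i ≤ℕᵇ toℕ j) then M i j else 0ℚ)

signed : ∀ {n} → Subset n → (Fin n → ℚ) → Fin n → ℚ
signed A w i = if i ∈ᵇ A then w i else - w i

signed-entry : ∀ p q u v k →
  (if p ∧ not q then u * v * k else 0ℚ) + (if not p ∧ q then u * v * k else 0ℚ)
    + (if p then u else - u) * (if q then v else - v) * k
  ≡ (if p ∧ q then u * v * k else 0ℚ) + (if not p ∧ not q then u * v * k else 0ℚ)
signed-entry true true u v k =
  solve 3 (λ u v k → con 0ℚ :+ con 0ℚ :+ u :* v :* k := u :* v :* k :+ con 0ℚ) refl u v k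
signed-entry true false u v k =
  solve 3 (λ u v k → u :* v :* k :+ con 0ℚ :+ u :* (:- v) :* k := con 0ℚ :+ con 0ℚ) refl u v k
signed-entry false true u v k =
  solve 3 (λ u v k → con 0ℚ :+ u :* v :* k :+ (:- u) :* v :* k := con 0ℚ :+ con 0ℚ) refl u v k
signed-entry false false u v k =
  solve 3 (λ u v k → con 0ℚ :+ con 0ℚ :+ (:- u) :* (:- v) :* k := con 0ℚ :+ u :* v :* k) refl u v k

quadForm-signed : ∀ {n} (A : Subset n) (w : Fin n → ℚ) (K : Fin n → Fin n → ℚ) →
  let M = scaledKernel w K in
  block A (∁ A) M + block (∁ A) A M + quadForm (signed A w) K
  ≡ block A A M + block (∁ A) (∁ A) M
quadForm-signed {n} A w K = begin
  block A (∁ A) M + block (∁ A) A M + quadForm (signed A w) K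
    ≡⟨ cong (_+ quadForm (signed A w) K) (sym (∑∑-distrib-+ (entry A (∁ A)) (entry (∁ A) A))) ⟩
  ∑[ i < n ] ∑[ j < n ] (entry A (∁ A) i j + entry (∁ A) A i j) + quadForm (signed A w) K
    ≡⟨ sym (∑∑-distrib-+ (λ i j → entry A (∁ A) i j + entry (∁ A) A i j)
                         (λ i j → signed A w i * signed A w j * K i j)) ⟩
  ∑[ i < n ] ∑[ j < n ] (entry A (∁ A) i j + entry (∁ A) A i j + signed A w i * signed A w j * K i j)
    ≡⟨ sum-cong-≗ (λ i → sum-cong-≗ (λ j → pointwise i j)) ⟩
  ∑[ i < n ] ∑[ j < n ] (entry A A i j + entry (∁ A) (∁ A) i j)
    ≡⟨ ∑∑-distrib-+ (entry A A) (entry (∁ A) (∁ A)) ⟩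
  block A A M + block (∁ A) (∁ A) M ∎
  where
  open ≡-Reasoning
  M : Fin n → Fin n → ℚ
  M = scaledKernel w K
  entry : Subset n → Subset n → Fin n → Fin n → ℚ
  entry S T i j = if (i ∈ᵇ S) ∧ (j ∈ᵇ T) then M i j else 0ℚ
  pointwise : ∀ i j → entry A (∁ A) i j + entry (∁ A) A i j + signed A w i * signed A w j * K i j
                      ≡ entry A A i j + entry (∁ A) (∁ A) i j
  pointwise i j rewrite lookup-map i not A | lookup-map j not A =
    signed-entry (lookup A i) (lookup A j) (w i) (w j) (K i j)

block-transpose : ∀ {n} (S T : Subset n) (M : Fin n → Fin n → ℚ) →
                  (∀ i j → M j i ≡ M i j) → block T S M ≡ block S T M
block-transpose S T M M-sym =
  trans (∑-comm (λ i j → if (i ∈ᵇ T) ∧ (j ∈ᵇ S) then M i j else 0ℚ))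
        (sum-cong-≗ (λ i → sum-cong-≗ (λ j →
          cong₂ (λ b m → if b then m else 0ℚ) (∧-comm (j ∈ᵇ T) (i ∈ᵇ S)) (M-sym i j))))

selfBlock-entry : ∀ p q b b' x {y} → y ≡ x → T b ⊎ T b' → 0ℚ ≤ x →
  (if p ∧ q then x else 0ℚ) ≤ (if p ∧ q ∧ b then x else 0ℚ) + (if q ∧ p ∧ b' then y else 0ℚ)
selfBlock-entry true  true  true  true  x refl _ 0≤x = p≤p+q x 0≤x
selfBlock-entry true  true  true  false x refl _ _   = p≤p+q x ≤-refl
selfBlock-entry true  true  false true  x refl _ _   = ≤-reflexive (sym (+-identityˡ x))
selfBlock-entry true  true  false false x refl (inj₁ ()) _
selfBlock-entry true  true  false false x refl (inj₂ ()) _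
selfBlock-entry true  false b     b'    x refl _ _   = p≤p+q 0ℚ ≤-refl
selfBlock-entry false true  b     b'    x refl _ _   = p≤p+q 0ℚ ≤-refl
selfBlock-entry false false b     b'    x refl _ _   = p≤p+q 0ℚ ≤-refl

selfBlock≤upperBlock : ∀ {n} (S : Subset n) (M : Fin n → Fin n → ℚ) →
  (∀ i j → M j i ≡ M i j) → (∀ i j → 0ℚ ≤ M i j) →
  block S S M ≤ upperBlock S M + upperBlock S M
selfBlock≤upperBlock {n} S M M-sym M≥0 = begin
  block S S M
    ≤⟨ sum-mono-≤ (λ i → sum-mono-≤ (λ j → selfBlock-entry (i ∈ᵇ S) (j ∈ᵇ S) _ _
         (M i j) (M-sym i j) (≤ᵇ-total i j) (M≥0 i j))) ⟩
  ∑[ i < n ] ∑[ j < n ] (upper i j + upper j i)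
    ≡⟨ ∑∑-distrib-+ upper (λ i j → upper j i) ⟩
  upperBlock S M + ∑[ i < n ] ∑[ j < n ] upper j i
    ≡⟨ cong (upperBlock S M +_) (∑-comm (λ i j → upper j i)) ⟩
  upperBlock S M + upperBlock S M ∎
  where
  open ≤-Reasoning
  upper : Fin n → Fin n → ℚ
  upper i j = if (i ∈ᵇ S) ∧ (j ∈ᵇ S) ∧ (toℕ i ≤ℕᵇ toℕ j) then M i j else 0ℚ
  ≤ᵇ-total : ∀ i j → T (toℕ i ≤ℕᵇ toℕ j) ⊎ T (toℕ j ≤ℕᵇ toℕ i)
  ≤ᵇ-total i j = Sum.map ℕ.≤⇒≤ᵇ ℕ.≤⇒≤ᵇ (ℕ.≤-total (toℕ i) (toℕ j))

scaledKernel-sym : ∀ {n} (w : Fin n → ℚ) (K : Fin n → Fin n → ℚ) → (∀ i j → K j i ≡ K i j) →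
                   ∀ i j → scaledKernel w K j i ≡ scaledKernel w K i j
scaledKernel-sym w K K-sym i j = cong₂ _*_ (*-comm (w j) (w i)) (K-sym i j)

minKernel-sym : ∀ {n} (a : Fin n → ℚ) → ∀ i j → minKernel a j i ≡ minKernel a i j
minKernel-sym a i j = ⊓-comm (a j) (a i)

crossBlock+crossBlock≤selfBlocks : ∀ {n} (A : Subset n) (w a : Fin n → ℚ) → (∀ i → 0ℚ ≤ a i) →
  let M = scaledKernel w (minKernel a) in
  block A (∁ A) M + block A (∁ A) M ≤ block A A M + block (∁ A) (∁ A) M
crossBlock+crossBlock≤selfBlocks A w a a≥0 = begin
  block A (∁ A) M + block A (∁ A) M
    ≡⟨ cong (block A (∁ A) M +_)
         (sym (block-transpose A (∁ A) M (scaledKernel-sym w (minKernel a) (minKernel-sym a)))) ⟩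
  block A (∁ A) M + block (∁ A) A M
    ≤⟨ p≤p+q _ (minKernel-psd a a≥0 (signed A w)) ⟩
  block A (∁ A) M + block (∁ A) A M + quadForm (signed A w) (minKernel a)
    ≡⟨ quadForm-signed A w (minKernel a) ⟩
  block A A M + block (∁ A) (∁ A) M ∎
  where
  open ≤-Reasoning
  M : Fin _ → Fin _ → ℚ
  M = scaledKernel w (minKernel a)

crossBlock≤upperBlocks : ∀ {n} (A : Subset n) (w a : Fin n → ℚ) →
  (∀ i → 0ℚ ≤ w i) → (∀ i → 0ℚ ≤ a i) →
  let M = scaledKernel w (minKernel a) in
  block A (∁ A) M ≤ upperBlock A M + upperBlock (∁ A) M
crossBlock≤upperBlocks {n} A w a w≥0 a≥0 = p+p≤q+q⇒p≤q (begin
  block A (∁ A) M + block A (∁ A) M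
    ≤⟨ crossBlock+crossBlock≤selfBlocks A w a a≥0 ⟩
  block A A M + block (∁ A) (∁ A) M
    ≤⟨ +-mono-≤ (selfBlock≤upperBlock A M M-sym M≥0) (selfBlock≤upperBlock (∁ A) M M-sym M≥0) ⟩
  (upperBlock A M + upperBlock A M) + (upperBlock (∁ A) M + upperBlock (∁ A) M)
    ≡⟨ interchange (upperBlock A M) (upperBlock A M) (upperBlock (∁ A) M) (upperBlock (∁ A) M) ⟩
  (upperBlock A M + upperBlock (∁ A) M) + (upperBlock A M + upperBlock (∁ A) M) ∎)
  where
  open ≤-Reasoning
  M : Fin n → Fin n → ℚ
  M = scaledKernel w (minKernel a)
  M-sym : ∀ i j → M j i ≡ M i j
  M-sym = scaledKernel-sym w (minKernel a) (minKernel-sym a)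
  M≥0 : ∀ i j → 0ℚ ≤ M i j
  M≥0 i j = nonNeg* (nonNeg* (w≥0 i) (w≥0 j)) (⊓-glb (a≥0 i) (a≥0 j))

α-nonNeg : ∀ {n} (l w : Fin n → ℚ) (wpos : ∀ i → 0ℚ < w i) →
           (∀ i → 0ℚ ≤ l i) → ∀ i → 0ℚ ≤ α l w wpos i
α-nonNeg l w wpos l≥0 i = nonNeg* (l≥0 i) (nonNegative⁻¹ w⁻¹ {{pos⇒nonNeg w⁻¹ {{w⁻¹>0}}}})
  where
  instance
    w>0 : Positive (w i)
    w>0 = positive (wpos i)
  w⁻¹ : ℚ
  w⁻¹ = (1/ w i) {{pos⇒nonZero (w i)}}
  w⁻¹>0 : Positive w⁻¹
  w⁻¹>0 = 1/pos⇒pos (w i)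

sumAcross≡block : ∀ {n} (l w : Fin n → ℚ) (wpos : ∀ i → 0ℚ < w i) (S T : Subset n) →
  sumAcross l w wpos S T ≡ block S T (scaledKernel w (minKernel (α l w wpos)))
sumAcross≡block l w wpos S T =
  ΣΣ≡∑∑ (λ i j → if (i ∈ᵇ S) ∧ (j ∈ᵇ T) then term l w wpos i j else 0ℚ)

sumWithin≡upperBlock : ∀ {n} (l w : Fin n → ℚ) (wpos : ∀ i → 0ℚ < w i) (S : Subset n) →
  sumWithin l w wpos S ≡ upperBlock S (scaledKernel w (minKernel (α l w wpos)))
sumWithin≡upperBlock l w wpos S =
  ΣΣ≡∑∑ (λ i j → if (i ∈ᵇ S) ∧ (j ∈ᵇ S) ∧ (toℕ i ≤ℕᵇ toℕ j) then term l w wpos i j else 0ℚ)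

lemma2 : (n : ℕ) (l w : Fin n → ℚ)
    → (∀ i → 0ℚ ≤ l i)
    → (wpos : ∀ i → 0ℚ < w i)
    → (A : Subset n)
    → sumAcross l w wpos A (∁ A)
    ≤ sumWithin l w wpos A + sumWithin l w wpos (∁ A)
lemma2 n l w l≥0 wpos A =
  subst₂ _≤_ (sym (sumAcross≡block l w wpos A (∁ A)))
             (sym (cong₂ _+_ (sumWithin≡upperBlock l w wpos A) (sumWithin≡upperBlock l w wpos (∁ A))))
             (crossBlock≤upperBlocks A w (α l w wpos) (λ i → <⇒≤ (wpos i)) (α-nonNeg l w wpos l≥0))
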